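{- Let $\Gamma$ be a tree with $l+1\geq 2$ leaves (vertices of degree $1$), with vertices $v_1,\dots,v_k$. Let $n\geq 1$ and let $\Gamma_n$ be the join of $\Gamma$ with the complete graph $K_n$ on vertices $w_1,\dots,w_n$. Let $H_n$ be the quotient of $\operatorname{Pic}^0(\Gamma_n)$ by the subgroup generated by the classes of $w_i-w_j$, $1\le i,j\le n$. Then $H_n$ can be generated by $l$ elements.
   Context: The join of two graphs $\Gamma_1,\Gamma_2$ is obtained from their disjoint union by joining every vertex of $\Gamma_1$ to every vertex of $\Gamma_2$ by an edge. For a finite connected graph $G$, $\operatorname{Div}(G)$ is the free abelian group on $V(G)$, $\operatorname{Div}^0(G)$ is the kernel of the degree map $\sum a_v v\mapsto\sum a_v$, the Laplacian $\Delta(G):\operatorname{Div}(G)\to\operatorname{Div}^0(G)$ is given by $v\mapsto(\deg v)\,v-\sum_{wv\in E(G)}w$, and the chip-firing group is $\operatorname{Pic}^0(G)=\operatorname{Div}^0(G)/\operatorname{im}\Delta(G)$. -}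

module Defs where

open import Data.Nat using (ℕ; zero; suc; _≤_)
open import Data.Integer using (ℤ; +_; _+_; _-_; _*_)
open import Data.Fin using (Fin; zero; suc; splitAt; _↑ʳ_; _↑ˡ_)
open import Data.Fin as F using ()
open import Data.Bool using (Bool; true; false; T; if_then_else_; not)
open import Data.List using (List; []; _∷_; _∷ʳ_; length)
open import Data.List.Relation.Unary.Linked using (Linked)
open import Data.List.Relation.Unary.Unique.Propositional using (Unique)
open import Data.Product using (Σ; ∃; _×_; _,_)
open import Data.Sum using (_⊎_; inj₁; inj₂)
open import Relation.Nullary using (¬_)
open import Relation.Nullary.Decidable using (⌊_⌋)
open import Relation.Binary.PropositionalEquality using (_≡_)

sumℤ : ∀ {m} → (Fin m → ℤ) → ℤ
sumℤ {zero}  f = + 0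
sumℤ {suc m} f = f zero + sumℤ (λ i → f (suc i))

count : ∀ {m} → (Fin m → Bool) → ℕ
count {zero}  p = 0
count {suc m} p = (if p zero then 1 else 0) Data.Nat.+ count (λ i → p (suc i))

record Graph (m : ℕ) : Set where
  field
    adj     : Fin m → Fin m → Bool
    adj-sym : ∀ u v → adj u v ≡ adj v u
    adj-irr : ∀ u → adj u u ≡ false
open Graph public

Adj : ∀ {m} → Graph m → Fin m → Fin m → Set
Adj G u v = T (adj G u v)

data Walk {m} (G : Graph m) : Fin m → Fin m → Set where
  here : ∀ {u} → Walk G u u
  step : ∀ {u v w} → Adj G u v → Walk G v w → Walk G u w

Connected : ∀ {m} → Graph m → Set
Connected G = ∀ u v → Walk G u v

-- A cycle: distinct vertices x, y₁, …, yᵣ, y (r ≥ 1, so ≥ 3 vertices),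
-- consecutive ones adjacent, and y adjacent to x.
HasCycle : ∀ {m} → Graph m → Set
HasCycle {m} G = Σ (Fin m) λ x → Σ (List (Fin m)) λ ys → Σ (Fin m) λ y →
  1 ≤ length ys × Unique (x ∷ (ys ∷ʳ y)) × Linked (Adj G) (x ∷ (ys ∷ʳ y)) × Adj G y x

IsTree : ∀ {m} → Graph m → Set
IsTree G = Connected G × ¬ HasCycle G

degree : ∀ {m} → Graph m → Fin m → ℕ
degree G v = count (λ u → adj G v u)

leafCount : ∀ {m} → Graph m → ℕ
leafCount G = count (λ v → ⌊ degree G v Data.Nat.≟ 1 ⌋)

completeGraph : (n : ℕ) → Graph n
completeGraph n = record
  { adj = λ u v → not ⌊ u F.≟ v ⌋
  ; adj-sym = sym′
  ; adj-irr = irr }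
  where
  open import Relation.Nullary using (yes; no)
  open import Relation.Binary.PropositionalEquality using (refl; sym)
  sym′ : ∀ u v → not ⌊ u F.≟ v ⌋ ≡ not ⌊ v F.≟ u ⌋
  sym′ u v with u F.≟ v | v F.≟ u
  ... | yes _ | yes _ = refl
  ... | no _  | no _  = refl
  ... | yes p | no q  = Data.Empty.⊥-elim (q (sym p)) where import Data.Empty
  ... | no p  | yes q = Data.Empty.⊥-elim (p (sym q)) where import Data.Empty
  irr : ∀ u → not ⌊ u F.≟ u ⌋ ≡ false
  irr u with u F.≟ u
  ... | yes _ = refl
  ... | no p  = Data.Empty.⊥-elim (p refl) where import Data.Empty

-- Join adjacency: vertices of G₁ are i ↑ˡ n₂, vertices of G₂ are n₁ ↑ʳ j.
joinAdj : ∀ {n₁ n₂} → Graph n₁ → Graph n₂ → Fin (n₁ Data.Nat.+ n₂) → Fin (n₁ Data.Nat.+ n₂) → Bool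
joinAdj {n₁} G₁ G₂ u v with splitAt n₁ u | splitAt n₁ v
... | inj₁ a | inj₁ b = adj G₁ a b
... | inj₂ a | inj₂ b = adj G₂ a b
... | inj₁ _ | inj₂ _ = true
... | inj₂ _ | inj₁ _ = true

join : ∀ {n₁ n₂} → Graph n₁ → Graph n₂ → Graph (n₁ Data.Nat.+ n₂)
join {n₁} G₁ G₂ = record { adj = joinAdj G₁ G₂ ; adj-sym = s ; adj-irr = i }
  where
  open import Relation.Binary.PropositionalEquality using (refl)
  s : ∀ u v → joinAdj G₁ G₂ u v ≡ joinAdj G₁ G₂ v u
  s u v with splitAt n₁ u | splitAt n₁ v
  ... | inj₁ a | inj₁ b = adj-sym G₁ a b
  ... | inj₂ a | inj₂ b = adj-sym G₂ a b
  ... | inj₁ _ | inj₂ _ = refl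
  ... | inj₂ _ | inj₁ _ = refl
  i : ∀ u → joinAdj G₁ G₂ u u ≡ false
  i u with splitAt n₁ u
  ... | inj₁ a = adj-irr G₁ a
  ... | inj₂ a = adj-irr G₂ a

Div : ℕ → Set
Div m = Fin m → ℤ

deg : ∀ {m} → Div m → ℤ
deg D = sumℤ D

vtx : ∀ {m} → Fin m → Div m
vtx v u = if ⌊ v F.≟ u ⌋ then + 1 else + 0

Δv : ∀ {m} → Graph m → Fin m → Div m
Δv G v u = (+ degree G v) * vtx v u - (if adj G v u then + 1 else + 0)

Δ : ∀ {m} → Graph m → Div m → Div m
Δ G f u = sumℤ (λ v → f v * Δv G v u)

module Submission where

-- Fix a vertex w of Kₙ and write  v − w  for the divisor [v] − [w] on Γₙ.
-- Every degree-zero divisor D equals Σᵥ D(v)·(v − w), so H_n is generated by the classes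
-- of the v − w; those with v in Kₙ vanish by definition of H_n.  For a vertex c of Γ,
-- the Laplacian of Γₙ gives
--      Δ(c) = (deg_Γ c + n)(c − w) − Σ_{a ∼ c} (a − w) − Σⱼ (wⱼ − w),
-- so in H_n the class of c − w together with those of all but one neighbour p of c
-- determines the class of p − w ("propagation").  Choose a leaf r of Γ as root and let the
-- l remaining leaves give the generators.  An induction over simple paths towards r, which
-- terminates because Γ has no cycles, shows that any property of vertices that holds at the
-- leaves other than r and is stable under propagation holds everywhere ("tree propagation").

open import Defs
open import Data.Nat using (ℕ; zero; suc; _≤_; _<_; _+_; z≤n; s≤s)
import Data.Nat.Properties as ℕP
open import Data.Integer using (ℤ; +_; _-_; _*_; -_)
open import Data.Integer using () renaming (_+_ to _+ℤ_)
import Data.Integer.Properties as ℤP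
open import Data.Integer.Tactic.RingSolver using (solve-∀)
open import Data.Fin using (Fin; zero; suc; _↑ʳ_; _↑ˡ_; splitAt)
import Data.Fin.Properties as FP
open import Data.Bool using (Bool; true; false; T; T?; if_then_else_; not)
open import Data.Unit using (tt)
open import Data.Empty using (⊥-elim)
open import Data.Sum using (_⊎_; inj₁; inj₂)
open import Data.Product using (Σ; _×_; _,_; proj₁; proj₂)
open import Data.List using (List; []; _∷_; _++_)
import Data.List.Properties as LP
open import Data.List.Relation.Unary.Any using (here; there)
open import Data.List.Relation.Unary.All using (All; []; _∷_)
import Data.List.Relation.Unary.All as All
import Data.List.Relation.Unary.All.Properties as AllP
open import Data.List.Relation.Unary.AllPairs using ([]; _∷_)
open import Data.List.Relation.Unary.Linked using (Linked; []; [-]; _∷_)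
open import Data.List.Relation.Unary.Unique.Propositional using (Unique)
open import Data.List.Membership.Propositional using (_∈_; _∉_)
open import Data.List.Membership.Propositional.Properties using (∈-∃++)
open import Function using (_∘_)
open import Data.Nat.Induction using (<-wellFounded)
open import Induction.WellFounded using (Acc; acc)
open import Relation.Nullary using (¬_; yes; no; ¬?; _×-dec_)
open import Relation.Nullary.Decidable using (⌊_⌋; toWitness; fromWitness)
open import Relation.Binary.PropositionalEquality

sumℤ-cong : ∀ {m} {f g : Fin m → ℤ} → (∀ i → f i ≡ g i) → sumℤ f ≡ sumℤ g
sumℤ-cong {zero}  eq = refl
sumℤ-cong {suc m} eq = cong₂ _+ℤ_ (eq zero) (sumℤ-cong (eq ∘ suc))

sumℤ-zero : ∀ {m} → sumℤ {m} (λ _ → + 0) ≡ + 0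
sumℤ-zero {zero}  = refl
sumℤ-zero {suc m} = trans (ℤP.+-identityˡ _) (sumℤ-zero {m})

sumℤ-+ : ∀ {m} (f g : Fin m → ℤ) → sumℤ (λ i → f i +ℤ g i) ≡ sumℤ f +ℤ sumℤ g
sumℤ-+ {zero}  f g = refl
sumℤ-+ {suc m} f g =
  trans (cong (f zero +ℤ g zero +ℤ_) (sumℤ-+ (f ∘ suc) (g ∘ suc))) (interchange (f zero) (g zero) (sumℤ (f ∘ suc)) (sumℤ (g ∘ suc)))
  where
  interchange : ∀ a b c d → a +ℤ b +ℤ (c +ℤ d) ≡ a +ℤ c +ℤ (b +ℤ d)
  interchange = solve-∀

sumℤ-*ˡ : ∀ {m} (z : ℤ) (f : Fin m → ℤ) → sumℤ (λ i → z * f i) ≡ z * sumℤ f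
sumℤ-*ˡ {zero}  z f = sym (ℤP.*-zeroʳ z)
sumℤ-*ˡ {suc m} z f =
  trans (cong (z * f zero +ℤ_) (sumℤ-*ˡ z (f ∘ suc))) (sym (ℤP.*-distribˡ-+ z (f zero) _))

sumℤ-*ʳ : ∀ {m} (z : ℤ) (f : Fin m → ℤ) → sumℤ (λ i → f i * z) ≡ sumℤ f * z
sumℤ-*ʳ z f = begin
  sumℤ (λ i → f i * z) ≡⟨ sumℤ-cong (λ i → ℤP.*-comm (f i) z) ⟩
  sumℤ (λ i → z * f i) ≡⟨ sumℤ-*ˡ z f ⟩
  z * sumℤ f           ≡⟨ ℤP.*-comm z (sumℤ f) ⟩
  sumℤ f * z           ∎
  where open ≡-Reasoning

sumℤ-- : ∀ {m} (f g : Fin m → ℤ) → sumℤ (λ i → f i - g i) ≡ sumℤ f - sumℤ g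
sumℤ-- {zero}  f g = refl
sumℤ-- {suc m} f g =
  trans (cong (f zero - g zero +ℤ_) (sumℤ-- (f ∘ suc) (g ∘ suc))) (regroup (f zero) (g zero) (sumℤ (f ∘ suc)) (sumℤ (g ∘ suc)))
  where
  regroup : ∀ a b c d → a - b +ℤ (c - d) ≡ a +ℤ c - (b +ℤ d)
  regroup = solve-∀

sumℤ-const : ∀ {m} (z : ℤ) → sumℤ {m} (λ _ → z) ≡ + m * z
sumℤ-const {zero}  z = sym (ℤP.*-zeroˡ z)
sumℤ-const {suc m} z =
  trans (cong (z +ℤ_) (sumℤ-const {m} z)) (sym (ℤP.suc-* (+ m) z))

sumℤ-split : ∀ k n (f : Fin (k + n) → ℤ) →
  sumℤ f ≡ sumℤ (λ i → f (i ↑ˡ n)) +ℤ sumℤ (λ j → f (k ↑ʳ j))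
sumℤ-split zero    n f = sym (ℤP.+-identityˡ (sumℤ f))
sumℤ-split (suc k) n f =
  trans (cong (f zero +ℤ_) (sumℤ-split k n (f ∘ suc))) (sym (ℤP.+-assoc (f zero) _ _))

indicator : Bool → ℤ
indicator b = if b then + 1 else + 0

diff : ∀ {m} → Fin m → Fin m → Div m
diff v w u = vtx v u - vtx w u

vtx-self : ∀ {m} (u : Fin m) → vtx u u ≡ + 1
vtx-self u with u FP.≟ u
... | yes _   = refl
... | no u≢u = ⊥-elim (u≢u refl)

vtx-≢ : ∀ {m} {u v : Fin m} → ¬ u ≡ v → vtx u v ≡ + 0
vtx-≢ {u = u} {v} u≢v with u FP.≟ v
... | yes u≡v = ⊥-elim (u≢v u≡v)
... | no _    = refl

vtx-sym : ∀ {m} (u v : Fin m) → vtx u v ≡ vtx v u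
vtx-sym u v with u FP.≟ v
... | yes refl = sym (vtx-self u)
... | no u≢v   = sym (vtx-≢ (u≢v ∘ sym))

vtx-inj : ∀ {m p} (h : Fin m → Fin p) → (∀ {a b} → h a ≡ h b → a ≡ b) →
  ∀ a b → vtx (h a) (h b) ≡ vtx a b
vtx-inj h inj a b with a FP.≟ b
... | yes refl = vtx-self (h a)
... | no a≢b   = vtx-≢ (a≢b ∘ inj)

sumℤ-vtx : ∀ {m} (v : Fin m) (h : Fin m → ℤ) → sumℤ (λ i → vtx v i * h i) ≡ h v
sumℤ-vtx {suc m} zero h =
  trans (cong₂ _+ℤ_ (ℤP.*-identityˡ (h zero)) (sumℤ-zero {m})) (ℤP.+-identityʳ (h zero))
sumℤ-vtx {suc m} (suc v) h = begin
  + 0 +ℤ sumℤ (λ i → vtx (suc v) (suc i) * h (suc i)) ≡⟨ ℤP.+-identityˡ _ ⟩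
  sumℤ (λ i → vtx (suc v) (suc i) * h (suc i))        ≡⟨ sumℤ-cong (λ i → cong (_* h (suc i)) (vtx-inj suc FP.suc-injective v i)) ⟩
  sumℤ (λ i → vtx v i * h (suc i))                    ≡⟨ sumℤ-vtx v (h ∘ suc) ⟩
  h (suc v)                                           ∎
  where open ≡-Reasoning

expand : ∀ {m} (h : Fin m → ℤ) (u : Fin m) → h u ≡ sumℤ (λ v → h v * vtx v u)
expand h u = sym (trans
  (sumℤ-cong (λ v → trans (ℤP.*-comm (h v) (vtx v u)) (cong (_* h v) (vtx-sym v u))))
  (sumℤ-vtx u h))

deg-vtx : ∀ {m} (v : Fin m) → deg (vtx v) ≡ + 1
deg-vtx v = trans (sumℤ-cong (λ i → sym (ℤP.*-identityʳ (vtx v i)))) (sumℤ-vtx v (λ _ → + 1))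

deg-diff : ∀ {m} (v w : Fin m) → deg (diff v w) ≡ + 0
deg-diff v w = trans (sumℤ-- (vtx v) (vtx w)) (cong₂ _-_ (deg-vtx v) (deg-vtx w))

expand-deg0 : ∀ {m} (D : Div m) → deg D ≡ + 0 → ∀ w u → sumℤ (λ v → D v * diff v w u) ≡ D u
expand-deg0 D deg0 w u = begin
  sumℤ (λ v → D v * (vtx v u - vtx w u))
    ≡⟨ sumℤ-cong (λ v → distribˡ-- (D v) (vtx v u) (vtx w u)) ⟩
  sumℤ (λ v → D v * vtx v u - D v * vtx w u)
    ≡⟨ sumℤ-- (λ v → D v * vtx v u) (λ v → D v * vtx w u) ⟩
  sumℤ (λ v → D v * vtx v u) - sumℤ (λ v → D v * vtx w u)
    ≡⟨ cong₂ _-_ (sym (expand D u)) (trans (sumℤ-*ʳ (vtx w u) D) (cong (_* vtx w u) deg0)) ⟩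
  D u - + 0
    ≡⟨ ℤP.+-identityʳ (D u) ⟩
  D u ∎
  where
  open ≡-Reasoning
  distribˡ-- : ∀ a b c → a * (b - c) ≡ a * b - a * c
  distribˡ-- = solve-∀

sumℤ-count : ∀ {m} (p : Fin m → Bool) → sumℤ (λ i → indicator (p i)) ≡ + count p
sumℤ-count {zero}  p = refl
sumℤ-count {suc m} p rewrite sumℤ-count (p ∘ suc) with p zero
... | true  = refl
... | false = refl

count-cong : ∀ {m} {f g : Fin m → Bool} → (∀ i → f i ≡ g i) → count f ≡ count g
count-cong {zero}  eq = refl
count-cong {suc m} eq =
  cong₂ _+_ (cong (λ b → if b then 1 else 0) (eq zero)) (count-cong (eq ∘ suc))

count-true : ∀ m → count {m} (λ _ → true) ≡ m
count-true zero    = refl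
count-true (suc m) = cong suc (count-true m)

count-split : ∀ k n (f : Fin (k + n) → Bool) →
  count f ≡ count (λ i → f (i ↑ˡ n)) + count (λ j → f (k ↑ʳ j))
count-split zero    n f = refl
count-split (suc k) n f rewrite count-split k n (f ∘ suc) with f zero
... | true  = refl
... | false = refl

_⊆ᵇ_ : ∀ {m} → (Fin m → Bool) → (Fin m → Bool) → Set
f ⊆ᵇ g = ∀ v → T (f v) → T (g v)

count-mono : ∀ {m} (f g : Fin m → Bool) → f ⊆ᵇ g → count f ≤ count g
count-mono {zero}  f g f⊆g = z≤n
count-mono {suc m} f g f⊆g with f zero in f0 | g zero in g0
... | true  | true  = s≤s (count-mono (f ∘ suc) (g ∘ suc) (f⊆g ∘ suc))
... | false | true  = ℕP.m≤n⇒m≤1+n (count-mono (f ∘ suc) (g ∘ suc) (f⊆g ∘ suc))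
... | false | false = count-mono (f ∘ suc) (g ∘ suc) (f⊆g ∘ suc)
... | true  | false = ⊥-elim (subst T g0 (f⊆g zero (subst T (sym f0) tt)))

count-strict : ∀ {m} (f g : Fin m → Bool) → f ⊆ᵇ g → (a : Fin m) → T (g a) → ¬ T (f a) →
  count f < count g
count-strict {suc m} f g f⊆g a ga ¬fa with f zero in f0 | g zero in g0 | a
... | true  | false | _     = ⊥-elim (subst T g0 (f⊆g zero (subst T (sym f0) tt)))
... | true  | true  | zero  = ⊥-elim (¬fa (subst T (sym f0) tt))
... | false | false | zero  = ⊥-elim (subst T g0 ga)
... | false | true  | zero  = s≤s (count-mono (f ∘ suc) (g ∘ suc) (f⊆g ∘ suc))
... | true  | true  | suc b = s≤s (count-strict (f ∘ suc) (g ∘ suc) (f⊆g ∘ suc) b ga ¬fa)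
... | false | true  | suc b = ℕP.m≤n⇒m≤1+n (count-strict (f ∘ suc) (g ∘ suc) (f⊆g ∘ suc) b ga ¬fa)
... | false | false | suc b = count-strict (f ∘ suc) (g ∘ suc) (f⊆g ∘ suc) b ga ¬fa

point : ∀ {m} → Fin m → Fin m → Bool
point a v = ⌊ a FP.≟ v ⌋

count-point : ∀ {m} (a : Fin m) → count (point a) ≡ 1
count-point a = ℤP.+-injective (trans (sym (sumℤ-count (point a))) (deg-vtx a))

point-⊆ : ∀ {m} {p : Fin m → Bool} {a : Fin m} → T (p a) → point a ⊆ᵇ p
point-⊆ {p = p} pa v a≡v = subst (T ∘ p) (toWitness a≡v) pa

count-one-unique : ∀ {m} (p : Fin m → Bool) → count p ≡ 1 →
  ∀ {a b} → T (p a) → T (p b) → a ≡ b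
count-one-unique p once {a} {b} pa pb with a FP.≟ b
... | yes a≡b = a≡b
... | no a≢b  = ⊥-elim (ℕP.<-irrefl refl (subst₂ _<_ (count-point b) once
                  (count-strict (point b) p (point-⊆ pb) a pa (a≢b ∘ sym ∘ toWitness))))

count-other : ∀ {m} (p : Fin m → Bool) → ¬ count p ≡ 1 →
  ∀ {a} → T (p a) → Σ (Fin m) λ b → ¬ b ≡ a × T (p b)
count-other p ¬once {a} pa with FP.any? (λ b → ¬? (b FP.≟ a) ×-dec T? (p b))
... | yes (b , b≢a , pb) = b , b≢a , pb
... | no none = ⊥-elim (¬once (ℕP.≤-antisym
        (subst (count p ≤_) (count-point a) (count-mono p (point a) only-a))
        (subst (_≤ count p) (count-point a) (count-mono (point a) p (point-⊆ pa)))))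
  where
  only-a : p ⊆ᵇ point a
  only-a b pb with b FP.≟ a
  ... | yes refl = fromWitness refl
  ... | no b≢a   = ⊥-elim (none (b , b≢a , pb))

record Enumeration {m} (p : Fin m → Bool) (c : ℕ) : Set where
  field
    elem     : Fin c → Fin m
    sound    : ∀ i → T (p (elem i))
    complete : ∀ v → T (p v) → Σ (Fin c) λ i → elem i ≡ v

enumeration : ∀ {m} (p : Fin m → Bool) → Enumeration p (count p)
enumeration {zero}  p = record { elem = λ () ; sound = λ () ; complete = λ () }
enumeration {suc m} p with enumeration (p ∘ suc) | p zero in p0
... | E | true = record
  { elem     = λ { zero → zero ; (suc i) → suc (elem i) }
  ; sound    = λ { zero → subst T (sym p0) tt ; (suc i) → sound i }
  ; complete = λ { zero _ → zero , refl
                 ; (suc v) pv → suc (proj₁ (complete v pv)) , cong suc (proj₂ (complete v pv)) } }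
  where open Enumeration E
... | E | false = record
  { elem     = suc ∘ elem
  ; sound    = sound
  ; complete = λ { zero p0′ → ⊥-elim (subst T p0 p0′)
                 ; (suc v) pv → proj₁ (complete v pv) , cong suc (proj₂ (complete v pv)) } }
  where open Enumeration E

enumerate : ∀ {m} (p : Fin m → Bool) {c} → count p ≡ c → Enumeration p c
enumerate p refl = enumeration p

join-cases : ∀ k n (u : Fin (k + n)) →
  (Σ (Fin k) λ b → b ↑ˡ n ≡ u) ⊎ (Σ (Fin n) λ j → k ↑ʳ j ≡ u)
join-cases k n u with splitAt k u in eq
... | inj₁ b = inj₁ (b , FP.splitAt⁻¹-↑ˡ eq)
... | inj₂ j = inj₂ (j , FP.splitAt⁻¹-↑ʳ eq)

module Cone {k : ℕ} (Γ : Graph k) (n : ℕ) where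

  Γₙ : Graph (k + n)
  Γₙ = join Γ (completeGraph n)

  adj-ΓΓ : ∀ a b → adj Γₙ (a ↑ˡ n) (b ↑ˡ n) ≡ adj Γ a b
  adj-ΓΓ a b rewrite FP.splitAt-↑ˡ k a n | FP.splitAt-↑ˡ k b n = refl

  adj-ΓK : ∀ a j → adj Γₙ (a ↑ˡ n) (k ↑ʳ j) ≡ true
  adj-ΓK a j rewrite FP.splitAt-↑ˡ k a n | FP.splitAt-↑ʳ k n j = refl

  degree-join : ∀ c → degree Γₙ (c ↑ˡ n) ≡ degree Γ c + n
  degree-join c = trans (count-split k n (adj Γₙ (c ↑ˡ n)))
    (cong₂ _+_ (count-cong (adj-ΓΓ c)) (trans (count-cong (adj-ΓK c)) (count-true n)))

  neighbours-join : ∀ c u → indicator (adj Γₙ (c ↑ˡ n) u) ≡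
    sumℤ (λ a → indicator (adj Γ c a) * vtx (a ↑ˡ n) u) +ℤ sumℤ (λ j → vtx (k ↑ʳ j) u)
  neighbours-join c u = begin
    indicator (adj Γₙ c′ u)
      ≡⟨ expand (indicator ∘ adj Γₙ c′) u ⟩
    sumℤ (λ v → indicator (adj Γₙ c′ v) * vtx v u)
      ≡⟨ sumℤ-split k n (λ v → indicator (adj Γₙ c′ v) * vtx v u) ⟩
    sumℤ (λ a → indicator (adj Γₙ c′ (a ↑ˡ n)) * vtx (a ↑ˡ n) u)
      +ℤ sumℤ (λ j → indicator (adj Γₙ c′ (k ↑ʳ j)) * vtx (k ↑ʳ j) u)
      ≡⟨ cong₂ _+ℤ_ (sumℤ-cong (λ a → cong (λ b → indicator b * vtx (a ↑ˡ n) u) (adj-ΓΓ c a)))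
                    (sumℤ-cong (λ j → trans (cong (λ b → indicator b * vtx (k ↑ʳ j) u) (adj-ΓK c j))
                                            (ℤP.*-identityˡ (vtx (k ↑ʳ j) u)))) ⟩
    sumℤ (λ a → indicator (adj Γ c a) * vtx (a ↑ˡ n) u) +ℤ sumℤ (λ j → vtx (k ↑ʳ j) u) ∎
    where
    open ≡-Reasoning
    c′ = c ↑ˡ n

  laplacian-join : ∀ (w : Fin n) c u → Δv Γₙ (c ↑ˡ n) u ≡
    + (degree Γ c + n) * diff (c ↑ˡ n) (k ↑ʳ w) u
      - sumℤ (λ a → indicator (adj Γ c a) * diff (a ↑ˡ n) (k ↑ʳ w) u)
      - sumℤ (λ j → diff (k ↑ʳ j) (k ↑ʳ w) u)
  laplacian-join w c u = begin
    + degree Γₙ (c ↑ˡ n) * X - indicator (adj Γₙ (c ↑ˡ n) u)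
      ≡⟨ cong₂ (λ e z → + e * X - z) (degree-join c) (neighbours-join c u) ⟩
    + (d + n) * X - (A +ℤ B)
      ≡⟨ cong (λ z → z * X - (A +ℤ B)) (ℤP.pos-+ d n) ⟩
    (+ d +ℤ + n) * X - (A +ℤ B)
      ≡⟨ regroup (+ d) (+ n) X Y A B ⟩
    (+ d +ℤ + n) * (X - Y) - (A - + d * Y) - (B - + n * Y)
      ≡⟨ cong₂ (λ e z → e * (X - Y) - z - (B - + n * Y)) (sym (ℤP.pos-+ d n)) (sym neighbour-diffs) ⟩
    + (d + n) * (X - Y) - sumℤ (λ a → indicator (adj Γ c a) * diff (a ↑ˡ n) w′ u) - (B - + n * Y)
      ≡⟨ cong (λ z → + (d + n) * (X - Y) - sumℤ (λ a → indicator (adj Γ c a) * diff (a ↑ˡ n) w′ u) - z)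
              (sym cone-diffs) ⟩
    + (d + n) * (X - Y) - sumℤ (λ a → indicator (adj Γ c a) * diff (a ↑ˡ n) w′ u)
      - sumℤ (λ j → diff (k ↑ʳ j) w′ u) ∎
    where
    open ≡-Reasoning
    w′ = k ↑ʳ w
    d  = degree Γ c
    X  = vtx (c ↑ˡ n) u
    Y  = vtx w′ u
    A  = sumℤ (λ a → indicator (adj Γ c a) * vtx (a ↑ˡ n) u)
    B  = sumℤ (λ j → vtx (k ↑ʳ j) u)
    regroup : ∀ D N X Y A B → (D +ℤ N) * X - (A +ℤ B) ≡ (D +ℤ N) * (X - Y) - (A - D * Y) - (B - N * Y)
    regroup = solve-∀
    distribˡ-- : ∀ a b c → a * (b - c) ≡ a * b - a * c
    distribˡ-- = solve-∀
    neighbour-diffs : sumℤ (λ a → indicator (adj Γ c a) * diff (a ↑ˡ n) w′ u) ≡ A - + d * Y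
    neighbour-diffs = begin
      sumℤ (λ a → indicator (adj Γ c a) * (vtx (a ↑ˡ n) u - Y))
        ≡⟨ sumℤ-cong (λ a → distribˡ-- (indicator (adj Γ c a)) (vtx (a ↑ˡ n) u) Y) ⟩
      sumℤ (λ a → indicator (adj Γ c a) * vtx (a ↑ˡ n) u - indicator (adj Γ c a) * Y)
        ≡⟨ sumℤ-- _ (λ a → indicator (adj Γ c a) * Y) ⟩
      A - sumℤ (λ a → indicator (adj Γ c a) * Y)
        ≡⟨ cong (λ z → A - z) (trans (sumℤ-*ʳ Y (indicator ∘ adj Γ c)) (cong (_* Y) (sumℤ-count (adj Γ c)))) ⟩
      A - + d * Y ∎
    cone-diffs : sumℤ (λ j → diff (k ↑ʳ j) w′ u) ≡ B - + n * Y
    cone-diffs = trans (sumℤ-- (λ j → vtx (k ↑ʳ j) u) (λ _ → Y)) (cong (λ z → B - z) (sumℤ-const {n} Y))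

comb : ∀ {m N} → (Fin m → ℤ) → (Fin m → Div N) → Div N
comb c E u = sumℤ (λ i → c i * E i u)

comb-+ : ∀ {m N} (c c′ : Fin m → ℤ) (E : Fin m → Div N) u →
  comb (λ i → c i +ℤ c′ i) E u ≡ comb c E u +ℤ comb c′ E u
comb-+ c c′ E u = trans (sumℤ-cong (λ i → ℤP.*-distribʳ-+ (E i u) (c i) (c′ i)))
                        (sumℤ-+ (λ i → c i * E i u) (λ i → c′ i * E i u))

comb-scale : ∀ {m N} (z : ℤ) (c : Fin m → ℤ) (E : Fin m → Div N) u →
  comb (λ i → z * c i) E u ≡ z * comb c E u
comb-scale z c E u = trans (sumℤ-cong (λ i → ℤP.*-assoc z (c i) (E i u)))
                           (sumℤ-*ˡ z (λ i → c i * E i u))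

comb-zero : ∀ {m N} (E : Fin m → Div N) u → comb (λ _ → + 0) E u ≡ + 0
comb-zero {m} E u = sumℤ-zero {m}

comb-vtx : ∀ {m N} (i : Fin m) (E : Fin m → Div N) u → comb (vtx i) E u ≡ E i u
comb-vtx i E u = sumℤ-vtx i (λ i′ → E i′ u)

module Quotient {N : ℕ} (G : Graph N) {n : ℕ} (w : Fin n → Fin N) {l : ℕ} (g : Fin l → Div N) where

  W : (Fin n → Fin n → ℤ) → Div N
  W a u = sumℤ (λ i → comb (a i) (λ j → diff (w i) (w j)) u)

  W-+ : ∀ a a′ u → W (λ i j → a i j +ℤ a′ i j) u ≡ W a u +ℤ W a′ u
  W-+ a a′ u = trans (sumℤ-cong (λ i → comb-+ (a i) (a′ i) (λ j → diff (w i) (w j)) u)) (sumℤ-+ (λ i → comb (a i) (λ j → diff (w i) (w j)) u) (λ i → comb (a′ i) (λ j → diff (w i) (w j)) u))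

  W-scale : ∀ z a u → W (λ i j → z * a i j) u ≡ z * W a u
  W-scale z a u = trans (sumℤ-cong (λ i → comb-scale z (a i) (λ j → diff (w i) (w j)) u)) (sumℤ-*ˡ z (λ i → comb (a i) (λ j → diff (w i) (w j)) u))

  W-zero : ∀ u → W (λ _ _ → + 0) u ≡ + 0
  W-zero u = trans (sumℤ-cong (λ i → comb-zero (λ j → diff (w i) (w j)) u)) (sumℤ-zero {n})

  -- D ≡ Σₜ cₜ gₜ modulo im Δ + ⟨wᵢ − wⱼ⟩: the class of D lies in the subgroup generated by the g's.
  -- The witness consists of the coefficients c, a firing script f and the coefficients a.
  record Span (D : Div N) : Set where
    constructor span
    field
      coeff   : Fin l → ℤ
      firing  : Div N
      swaps   : Fin n → Fin n → ℤ
      witness : ∀ u → D u - comb coeff g u ≡ Δ G firing u +ℤ W swaps u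

  Span-explicit : ∀ {D} → Span D → Σ (Fin l → ℤ) λ c → Σ (Div N) λ f → Σ (Fin n → Fin n → ℤ) λ a →
    ∀ u → D u - comb c g u ≡ Δ G f u +ℤ W a u
  Span-explicit (span c f a eq) = c , f , a , eq

  Span-ext : ∀ {D D′} → (∀ u → D u ≡ D′ u) → Span D → Span D′
  Span-ext D≡D′ (span c f a eq) = span c f a λ u → trans (cong (_- comb c g u) (sym (D≡D′ u))) (eq u)

  Span-+ : ∀ {D E} → Span D → Span E → Span (λ u → D u +ℤ E u)
  Span-+ {D} {E} (span c f a p) (span c′ f′ a′ q) =
    span (λ t → c t +ℤ c′ t) (λ v → f v +ℤ f′ v) (λ i j → a i j +ℤ a′ i j) λ u → begin
      D u +ℤ E u - comb (λ t → c t +ℤ c′ t) g u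
        ≡⟨ cong (λ z → D u +ℤ E u - z) (comb-+ c c′ g u) ⟩
      D u +ℤ E u - (comb c g u +ℤ comb c′ g u)
        ≡⟨ regroup₁ (D u) (E u) (comb c g u) (comb c′ g u) ⟩
      (D u - comb c g u) +ℤ (E u - comb c′ g u)
        ≡⟨ cong₂ _+ℤ_ (p u) (q u) ⟩
      (Δ G f u +ℤ W a u) +ℤ (Δ G f′ u +ℤ W a′ u)
        ≡⟨ regroup₂ (Δ G f u) (W a u) (Δ G f′ u) (W a′ u) ⟩
      (Δ G f u +ℤ Δ G f′ u) +ℤ (W a u +ℤ W a′ u)
        ≡⟨ sym (cong₂ _+ℤ_ (comb-+ f f′ (Δv G) u) (W-+ a a′ u)) ⟩
      Δ G (λ v → f v +ℤ f′ v) u +ℤ W (λ i j → a i j +ℤ a′ i j) u ∎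
    where
    open ≡-Reasoning
    regroup₁ : ∀ d e x y → d +ℤ e - (x +ℤ y) ≡ (d - x) +ℤ (e - y)
    regroup₁ = solve-∀
    regroup₂ : ∀ a b c d → (a +ℤ b) +ℤ (c +ℤ d) ≡ (a +ℤ c) +ℤ (b +ℤ d)
    regroup₂ = solve-∀

  Span-scale : ∀ {D} z → Span D → Span (λ u → z * D u)
  Span-scale {D} z (span c f a p) = span (λ t → z * c t) (λ v → z * f v) (λ i j → z * a i j) λ u → begin
      z * D u - comb (λ t → z * c t) g u   ≡⟨ cong (λ y → z * D u - y) (comb-scale z c g u) ⟩
      z * D u - z * comb c g u             ≡⟨ sym (distribˡ-- z (D u) (comb c g u)) ⟩
      z * (D u - comb c g u)               ≡⟨ cong (z *_) (p u) ⟩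
      z * (Δ G f u +ℤ W a u)               ≡⟨ ℤP.*-distribˡ-+ z (Δ G f u) (W a u) ⟩
      z * Δ G f u +ℤ z * W a u             ≡⟨ sym (cong₂ _+ℤ_ (comb-scale z f (Δv G) u) (W-scale z a u)) ⟩
      Δ G (λ v → z * f v) u +ℤ W (λ i j → z * a i j) u ∎
    where
    open ≡-Reasoning
    distribˡ-- : ∀ a b c → a * (b - c) ≡ a * b - a * c
    distribˡ-- = solve-∀

  Span-- : ∀ {D E} → Span D → Span E → Span (λ u → D u - E u)
  Span-- {D} {E} sD sE = Span-ext (λ u → cong (D u +ℤ_) (ℤP.-1*i≡-i (E u)))
                                  (Span-+ sD (Span-scale (- + 1) sE))

  Span-relation : ∀ f a → Span (λ u → Δ G f u +ℤ W a u)
  Span-relation f a = span (λ _ → + 0) f a λ u →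
    trans (cong (λ z → Δ G f u +ℤ W a u - z) (comb-zero g u)) (ℤP.+-identityʳ _)

  Span-zero : Span (λ _ → + 0)
  Span-zero = Span-ext (λ u → cong₂ _+ℤ_ (comb-zero (Δv G) u) (W-zero u))
                       (Span-relation (λ _ → + 0) (λ _ _ → + 0))

  Span-zero-scale : ∀ {z} (D : Div N) → z ≡ + 0 → Span (λ u → z * D u)
  Span-zero-scale D refl = Span-zero

  Span-sum : ∀ {m} (E : Fin m → Div N) → (∀ i → Span (E i)) → Span (λ u → sumℤ (λ i → E i u))
  Span-sum {zero}  E sE = Span-zero
  Span-sum {suc m} E sE = Span-+ (sE zero) (Span-sum (E ∘ suc) (sE ∘ suc))

  Span-gen : ∀ t → Span (g t)
  Span-gen t = span (vtx t) (λ _ → + 0) (λ _ _ → + 0) λ u → begin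
    g t u - comb (vtx t) g u          ≡⟨ cong (λ z → g t u - z) (comb-vtx t g u) ⟩
    g t u - g t u                     ≡⟨ ℤP.+-inverseʳ (g t u) ⟩
    + 0                               ≡⟨ sym (cong₂ _+ℤ_ (comb-zero (Δv G) u) (W-zero u)) ⟩
    Δ G (λ _ → + 0) u +ℤ W (λ _ _ → + 0) u ∎
    where open ≡-Reasoning

  Span-Δv : ∀ v → Span (Δv G v)
  Span-Δv v = Span-ext (λ u → trans (cong₂ _+ℤ_ (comb-vtx v (Δv G) u) (W-zero u)) (ℤP.+-identityʳ _))
                       (Span-relation (vtx v) (λ _ _ → + 0))

  Span-diff : ∀ i j → Span (diff (w i) (w j))
  Span-diff i j = Span-ext sifted (Span-relation (λ _ → + 0) (λ i′ j′ → vtx i i′ * vtx j j′))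
    where
    sifted : ∀ u → Δ G (λ _ → + 0) u +ℤ W (λ i′ j′ → vtx i i′ * vtx j j′) u ≡ diff (w i) (w j) u
    sifted u = begin
      Δ G (λ _ → + 0) u +ℤ W (λ i′ j′ → vtx i i′ * vtx j j′) u
        ≡⟨ cong (_+ℤ W (λ i′ j′ → vtx i i′ * vtx j j′) u) (comb-zero (Δv G) u) ⟩
      + 0 +ℤ W (λ i′ j′ → vtx i i′ * vtx j j′) u
        ≡⟨ ℤP.+-identityˡ _ ⟩
      sumℤ (λ i′ → comb (λ j′ → vtx i i′ * vtx j j′) (λ j′ → diff (w i′) (w j′)) u)
        ≡⟨ sumℤ-cong (λ i′ → comb-scale (vtx i i′) (vtx j) (λ j′ → diff (w i′) (w j′)) u) ⟩
      sumℤ (λ i′ → vtx i i′ * comb (vtx j) (λ j′ → diff (w i′) (w j′)) u)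
        ≡⟨ sumℤ-cong (λ i′ → cong (vtx i i′ *_) (comb-vtx j (λ j′ → diff (w i′) (w j′)) u)) ⟩
      sumℤ (λ i′ → vtx i i′ * diff (w i′) (w j) u)
        ≡⟨ sumℤ-vtx i (λ i′ → diff (w i′) (w j) u) ⟩
      diff (w i) (w j) u ∎
      where open ≡-Reasoning

module Propagation {k n : ℕ} (Γ : Graph k) (w : Fin n) {l : ℕ} (g : Fin l → Div (k + n)) where
  open Cone Γ n
  open Quotient Γₙ (k ↑ʳ_) g

  toCone : Fin k → Div (k + n)
  toCone c = diff (c ↑ˡ n) (k ↑ʳ w)

  Span-neighbours : ∀ c → Span (toCone c) →
    Span (λ u → sumℤ (λ a → indicator (adj Γ c a) * toCone a u))
  Span-neighbours c sc = Span-ext rearranged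
    (Span-- (Span-- (Span-scale (+ (degree Γ c + n)) sc) (Span-Δv (c ↑ˡ n)))
            (Span-sum (λ j → diff (k ↑ʳ j) (k ↑ʳ w)) (λ j → Span-diff j w)))
    where
    cancel : ∀ P Q R → P - (P - Q - R) - R ≡ Q
    cancel = solve-∀
    rearranged : ∀ u → + (degree Γ c + n) * toCone c u - Δv Γₙ (c ↑ˡ n) u
                         - sumℤ (λ j → diff (k ↑ʳ j) (k ↑ʳ w) u)
                       ≡ sumℤ (λ a → indicator (adj Γ c a) * toCone a u)
    rearranged u = trans (cong (λ z → + (degree Γ c + n) * toCone c u - z - sumℤ (λ j → diff (k ↑ʳ j) (k ↑ʳ w) u))
                               (laplacian-join w c u))
                         (cancel (+ (degree Γ c + n) * toCone c u)
                                 (sumℤ (λ a → indicator (adj Γ c a) * toCone a u))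
                                 (sumℤ (λ j → diff (k ↑ʳ j) (k ↑ʳ w) u)))

  propagate : ∀ {c p} → Adj Γ c p → Span (toCone c) →
    (∀ a → Adj Γ c a → ¬ a ≡ p → Span (toCone a)) → Span (toCone p)
  propagate {c} {p} cp sc others = Span-ext isolate
    (Span-- (Span-neighbours c sc) (Span-sum (λ a u → coeff a * toCone a u) other-term))
    where
    coeff : Fin k → ℤ
    coeff a = indicator (adj Γ c a) - vtx p a
    other-term : ∀ a → Span (λ u → coeff a * toCone a u)
    other-term a with a FP.≟ p | adj Γ c a in ca
    ... | yes refl | true  = Span-zero-scale (toCone a) (cong (λ z → + 1 - z) (vtx-self a))
    ... | yes refl | false = ⊥-elim (subst T ca cp)
    ... | no a≢p   | true  = Span-scale (+ 1 - vtx p a) (others a (subst T (sym ca) tt) a≢p)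
    ... | no a≢p   | false = Span-zero-scale (toCone a) (cong (λ z → + 0 - z) (vtx-≢ (a≢p ∘ sym)))
    cancel : ∀ i δ y → i * y - (i - δ) * y ≡ δ * y
    cancel = solve-∀
    isolate : ∀ u → sumℤ (λ a → indicator (adj Γ c a) * toCone a u) - sumℤ (λ a → coeff a * toCone a u)
                    ≡ toCone p u
    isolate u = begin
      sumℤ (λ a → indicator (adj Γ c a) * toCone a u) - sumℤ (λ a → coeff a * toCone a u)
        ≡⟨ sym (sumℤ-- (λ a → indicator (adj Γ c a) * toCone a u) (λ a → coeff a * toCone a u)) ⟩
      sumℤ (λ a → indicator (adj Γ c a) * toCone a u - coeff a * toCone a u)
        ≡⟨ sumℤ-cong (λ a → cancel (indicator (adj Γ c a)) (vtx p a) (toCone a u)) ⟩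
      sumℤ (λ a → vtx p a * toCone a u)
        ≡⟨ sumℤ-vtx p (λ a → toCone a u) ⟩
      toCone p u ∎
      where open ≡-Reasoning

Unique-prefix : ∀ {A : Set} (xs : List A) {ys} → Unique (xs ++ ys) → Unique xs
Unique-prefix []       _              = []
Unique-prefix (x ∷ xs) (x∉ ∷ unique) = AllP.++⁻ˡ xs x∉ ∷ Unique-prefix xs unique

Linked-prefix : ∀ {A : Set} {R : A → A → Set} (xs : List A) {ys} → Linked R (xs ++ ys) → Linked R xs
Linked-prefix []           _          = []
Linked-prefix (x ∷ [])     _          = [-]
Linked-prefix (x ∷ y ∷ xs) (r ∷ rest) = r ∷ Linked-prefix (y ∷ xs) rest

module Paths {k : ℕ} (Γ : Graph k) (r : Fin k) where
  open import Data.List.Membership.DecPropositional (FP._≟_ {k}) using (_∈?_)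

  data EndsAtRoot : List (Fin k) → Set where
    at-root : EndsAtRoot (r ∷ [])
    via     : ∀ {x xs} → EndsAtRoot xs → EndsAtRoot (x ∷ xs)

  ends-∈ : ∀ {xs} → EndsAtRoot xs → r ∈ xs
  ends-∈ at-root = here refl
  ends-∈ (via e) = there (ends-∈ e)

  PathToRoot : Fin k → List (Fin k) → Set
  PathToRoot v L = Unique (v ∷ L) × Linked (Adj Γ) (v ∷ L) × EndsAtRoot (v ∷ L)

  path-adj : ∀ {c p rest} → PathToRoot c (p ∷ rest) → Adj Γ c p
  path-adj (_ , cp ∷ _ , _) = cp

  path-≢root : ∀ {c p rest} → PathToRoot c (p ∷ rest) → ¬ c ≡ r
  path-≢root ((c∉ ∷ _) , _ , via e) = All.lookup c∉ (ends-∈ e)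

  suffix : ∀ {y xs} → y ∈ xs → Unique xs → Linked (Adj Γ) xs → EndsAtRoot xs →
    Σ (List (Fin k)) (PathToRoot y)
  suffix {xs = x ∷ xs}     (here refl) U Lk E = xs , U , Lk , E
  suffix {xs = x ∷ []}     (there ())  U Lk E
  suffix {xs = x ∷ _ ∷ _} (there y∈) (_ ∷ U) (_ ∷ Lk) (via E) = suffix y∈ U Lk E

  follow : ∀ {x v} L → PathToRoot x L → Walk Γ x v → Σ (List (Fin k)) (PathToRoot v)
  follow L path here = L , path
  follow {x} L (U , Lk , E) (step {v = y} xy walk) with y ∈? (x ∷ L)
  ... | yes y∈ = let (L′ , path′) = suffix y∈ U Lk E in follow L′ path′ walk
  ... | no y∉  = follow (x ∷ L) (AllP.¬Any⇒All¬ _ y∉ ∷ U , subst T (adj-sym Γ x y) xy ∷ Lk , via E) walk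

  path-to-root : Connected Γ → ∀ v → Σ (List (Fin k)) (PathToRoot v)
  path-to-root connected v = follow [] (([] ∷ []) , [-] , at-root) (connected r v)

  -- Without cycles, a neighbour a ≠ p of c does not lie on a simple path c ∷ p ∷ rest:
  -- otherwise c, p, …, a would close a cycle.
  neighbour-off-path : ¬ HasCycle Γ → ∀ {c p a rest} → Unique (c ∷ p ∷ rest) →
    Linked (Adj Γ) (c ∷ p ∷ rest) → Adj Γ c a → ¬ a ≡ p → a ∉ c ∷ p ∷ rest
  neighbour-off-path acyclic {c} U Lk ca a≢p (here refl)         = subst T (adj-irr Γ c) ca
  neighbour-off-path acyclic U Lk ca a≢p (there (here refl))     = a≢p refl
  neighbour-off-path acyclic {c} {p} {a} U Lk ca a≢p (there (there a∈rest))
    with ∈-∃++ a∈rest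
  ... | pre , post , refl = acyclic (c , p ∷ pre , a , s≤s z≤n ,
          Unique-prefix cycle (subst Unique split U) ,
          Linked-prefix cycle (subst (Linked (Adj Γ)) split Lk) ,
          subst T (adj-sym Γ c a) ca)
    where
    cycle : List (Fin k)
    cycle = c ∷ p ∷ pre ++ a ∷ []
    split : c ∷ p ∷ pre ++ a ∷ post ≡ cycle ++ post
    split = cong (λ xs → c ∷ p ∷ xs) (sym (LP.++-assoc pre (a ∷ []) post))

  off : List (Fin k) → ℕ
  off L = count (λ v → not ⌊ v ∈? L ⌋)

  off-∷ : ∀ {a L} → a ∉ L → off (a ∷ L) < off L
  off-∷ {a} {L} a∉L = count-strict _ _ shrink a (∉⇒T a∉L) (λ t → T⇒∉ t (here refl))
    where
    ∉⇒T : ∀ {v} → v ∉ L → T (not ⌊ v ∈? L ⌋)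
    ∉⇒T {v} v∉ with v ∈? L
    ... | yes v∈ = v∉ v∈
    ... | no _   = tt
    T⇒∉ : ∀ {v xs} → T (not ⌊ v ∈? xs ⌋) → v ∉ xs
    T⇒∉ {v} {xs} t with v ∈? xs
    ... | no v∉ = v∉
    shrink : ∀ v → T (not ⌊ v ∈? (a ∷ L) ⌋) → T (not ⌊ v ∈? L ⌋)
    shrink v t = ∉⇒T (T⇒∉ t ∘ there)

module TreePropagation {k : ℕ} (Γ : Graph k) (r : Fin k) (P : Fin k → Set)
  (at-leaves : ∀ c → degree Γ c ≡ 1 → ¬ c ≡ r → P c)
  (propagate : ∀ {c p} → Adj Γ c p → P c → (∀ a → Adj Γ c a → ¬ a ≡ p → P a) → P p) where
  open Paths Γ r

  -- Both ends of the first edge c → p of a simple path towards r satisfy P.  Induction on the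
  -- number of vertices off the path: each neighbour a ≠ p of c extends the path by acyclicity.
  first-edge : ¬ HasCycle Γ → ∀ {c p rest} → PathToRoot c (p ∷ rest) →
    Acc _<_ (off (c ∷ p ∷ rest)) → P c × P p
  first-edge acyclic {c} {p} path@(U , Lk , E) (acc smaller) with degree Γ c ℕP.≟ 1
  ... | yes leaf = Pc , propagate (path-adj path) Pc no-other-neighbour
    where
    Pc : P c
    Pc = at-leaves c leaf (path-≢root path)
    no-other-neighbour : ∀ a → Adj Γ c a → ¬ a ≡ p → P a
    no-other-neighbour a ca a≢p = ⊥-elim (a≢p (count-one-unique (adj Γ c) leaf ca (path-adj path)))
  ... | no ¬leaf = Pc , propagate (path-adj path) Pc (λ a ca a≢p → proj₁ (beyond a ca a≢p))
    where
    beyond : ∀ a → Adj Γ c a → ¬ a ≡ p → P a × P c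
    beyond a ca a≢p = first-edge acyclic
      (AllP.¬Any⇒All¬ _ a∉ ∷ U , subst T (adj-sym Γ c a) ca ∷ Lk , via E) (smaller (off-∷ a∉))
      where a∉ = neighbour-off-path acyclic U Lk ca a≢p
    Pc : P c
    Pc with count-other (adj Γ c) ¬leaf (path-adj path)
    ... | d , d≢p , cd = proj₂ (beyond d cd d≢p)

  -- A vertex v ≠ r starts a simple path to r; r itself is the second vertex of the path y ∷ r
  -- for a neighbour y.
  everywhere : IsTree Γ → Σ (Fin k) (Adj Γ r) → ∀ v → P v
  everywhere (connected , acyclic) (y , ry) v with path-to-root connected v
  ... | p ∷ rest , path = proj₁ (first-edge acyclic path (<-wellFounded _))
  ... | [] , (_ , _ , via ())
  ... | [] , (_ , _ , at-root) =
    proj₂ (first-edge acyclic (((y≢r ∷ []) ∷ [] ∷ []) , subst T (adj-sym Γ r y) ry ∷ [-] , via at-root)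
                      (<-wellFounded _))
    where
    y≢r : ¬ y ≡ r
    y≢r refl = subst T (adj-irr Γ r) ry

theoremB : (k l n : ℕ) (Γ : Graph k) → IsTree Γ → leafCount Γ ≡ suc l → 1 ≤ l → 1 ≤ n →
    Σ (Fin l → Div (k + n)) λ g →
      ((t : Fin l) → deg (g t) ≡ + 0) ×
      ((D : Div (k + n)) → deg D ≡ + 0 →
        Σ (Fin l → ℤ) λ c → Σ (Div (k + n)) λ f → Σ (Fin n → Fin n → ℤ) λ a →
          (u : Fin (k + n)) →
            D u - sumℤ (λ t → c t * g t u)
              ≡ Δ (join Γ (completeGraph n)) f u
                +ℤ sumℤ (λ i → sumℤ (λ j → a i j * (vtx (k ↑ʳ i) u - vtx (k ↑ʳ j) u))))
theoremB k l (suc n′) Γ tree leafCount≡ _ (s≤s z≤n) =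
  g , (λ t → deg-diff (Leaves.elem (suc t) ↑ˡ n) w) ,
  λ D deg0 → Span-explicit (Span-ext (expand-deg0 D deg0 w)
    (Span-sum (λ v u → D v * diff v w u) (λ v → Span-scale (D v) (to-apex v))))
  where
  n = suc n′
  w = k ↑ʳ zero
  module Leaves = Enumeration (enumerate (λ v → ⌊ degree Γ v ℕP.≟ 1 ⌋) leafCount≡)
  r = Leaves.elem zero
  g : Fin l → Div (k + n)
  g t = diff (Leaves.elem (suc t) ↑ˡ n) w
  open Cone Γ n
  open Quotient Γₙ (k ↑ʳ_) g
  open Propagation Γ zero g

  leaf-generates : ∀ c → degree Γ c ≡ 1 → ¬ c ≡ r → Span (toCone c)
  leaf-generates c leaf c≢r with Leaves.complete c (fromWitness leaf)
  ... | zero  , refl = ⊥-elim (c≢r refl)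
  ... | suc t , refl = Span-gen t

  -- The root is a leaf, so it has a neighbour.
  module RootNeighbour = Enumeration (enumerate (adj Γ r) (toWitness (Leaves.sound zero)))

  to-apex : ∀ v → Span (diff v w)
  to-apex v with join-cases k n v
  ... | inj₁ (c , refl) = TreePropagation.everywhere Γ r (Span ∘ toCone) leaf-generates propagate
                            tree (RootNeighbour.elem zero , RootNeighbour.sound zero) c
  ... | inj₂ (j , refl) = Span-diff j zero
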